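{- For the prism graphs $G_3=C_3\square P_2$ and $G_6=C_6\square P_2$, one has $\zeta(G_3)=9$ and $\zeta(G_6)=51$.
   Context: $G_n=C_n\square P_2$ is the prism graph with vertex set $\{(t,i),(b,i): i\in\mathbb{Z}_n\}$, with $(t,i)$ adjacent to $(t,i\pm1)$ and $(b,i)$, and $(b,i)$ adjacent to $(b,i\pm1)$ and $(t,i)$. $\zeta(G)$ denotes the number of dominating sets of $G$ of minimum size $\gamma(G)$, counting distinct vertex subsets of the labeled graph separately. -}

module Defs where

open import Data.Bool using (Bool; true; false; T; _∧_; _∨_; not; if_then_else_)
open import Data.Nat using (ℕ; zero; suc; _+_; _≤_; _≡ᵇ_)
open import Data.Fin using (Fin; zero; suc; toℕ)
open import Data.Fin.Subset using (Subset; ∣_∣)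
open import Data.Vec using (Vec; []; _∷_; lookup)
open import Data.List using (List; []; _∷_; map; _++_)
open import Data.Bool.ListAction using (any; all)
open import Data.Nat.DivMod using (_%_; m%n<n)
open import Function.Bundles using (_↔_)
open import Data.Product using (_×_; _,_; Σ; ∃)
open import Relation.Binary.PropositionalEquality using (_≡_)
open import Relation.Nullary using (Dec; yes; no)
open import Relation.Nullary.Decidable using (⌊_⌋)
open import Data.Fin using (_≟_)

-- Vertices of the prism C_n □ P_2: (t , i) encoded as (true , i), (b , i) as (false , i).
Vertex : ℕ → Set
Vertex n = Bool × Fin n

cycSucc : ∀ {n} → Fin n → Fin n
cycSucc {suc n} i = Data.Fin.fromℕ< (m%n<n (suc (toℕ i)) (suc n))

cycPred : ∀ {n} → Fin n → Fin n
cycPred {suc n} zero    = Data.Fin.fromℕ n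
cycPred {suc n} (suc j) = Data.Fin.inject₁ j

eqF : ∀ {n} → Fin n → Fin n → Bool
eqF i j = ⌊ i ≟ j ⌋

eqB : Bool → Bool → Bool
eqB true  y = y
eqB false y = not y

adj : ∀ {n} → Vertex n → Vertex n → Bool
adj (s , i) (s' , j) =
  (eqB s s' ∧ (eqF j (cycSucc i) ∨ eqF j (cycPred i)))
  ∨ (not (eqB s s') ∧ eqF i j)

Adj : ∀ {n} → Vertex n → Vertex n → Set
Adj u v = T (adj u v)

-- A vertex set of G_n: a subset of the vertices (characteristic function
-- for the top row and the bottom row, indexed by Fin n).
VSet : ℕ → Set
VSet n = Vec Bool n × Vec Bool n

size : ∀ {n} → VSet n → ℕ
size (S₁ , S₂) = ∣ S₁ ∣ + ∣ S₂ ∣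

allFinL : ∀ n → List (Fin n)
allFinL zero    = []
allFinL (suc n) = zero ∷ map suc (allFinL n)

allVertices : ∀ n → List (Vertex n)
allVertices n = map (true ,_) (allFinL n) ++ map (false ,_) (allFinL n)

memb : ∀ {n} → Vertex n → VSet n → Bool
memb (true  , i) (S₁ , S₂) = lookup S₁ i
memb (false , i) (S₁ , S₂) = lookup S₂ i

dominatesᵇ : ∀ {n} → VSet n → Vertex n → Bool
dominatesᵇ {n} D v = memb v D ∨ any (λ u → memb u D ∧ adj u v) (allVertices n)

Dominating : ∀ {n} → VSet n → Set
Dominating {n} D = T (all (dominatesᵇ D) (allVertices n))

IsDominationNumber : ℕ → ℕ → Set
IsDominationNumber n γ =
  (∃ λ (D : VSet n) → Dominating D × size D ≡ γ)
  × (∀ (D : VSet n) → Dominating D → γ ≤ size D)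

-- ζ(G_n) = k : the minimum dominating sets of G_n (dominating sets of size
-- γ(G_n)) are in bijection with Fin k, i.e. there are exactly k of them.
Zeta≡ : ℕ → ℕ → Set
Zeta≡ n k = ∃ λ γ → IsDominationNumber n γ
  × (Fin k ↔ Σ (VSet n) (λ D → Dominating D × size D ≡ γ))

{-# OPTIONS --safe #-}
module Submission where

-- The 2²ⁿ vertex sets of G_n are listed
-- without repetition; the minimum dominating sets are then exactly the entries
-- of this list that dominate and have size γ, so ζ is the length of the
-- filtered list. With γ(G₃) = 2 and γ(G₆) = 4, minimality of γ is itself an
-- exhaustive check over the same list.

open import Defs
open import Data.Bool using (Bool; true; false)
open import Data.Bool.Properties using (T?; T-irrelevant)
open import Data.Empty using (⊥-elim)
open import Data.Fin using (Fin; zero; suc)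
open import Data.List using (List; []; _∷_; length; lookup; filter; cartesianProduct; cartesianProductWith)
open import Data.List.Membership.Propositional using (_∈_)
open import Data.List.Membership.Propositional.Properties
  using (∈-lookup; ∈-filter⁺; ∈-filter⁻; ∈-cartesianProductWith⁺; ∈-cartesianProduct⁺)
import Data.List.Relation.Unary.All as All
open import Data.List.Relation.Unary.AllPairs using ([]; _∷_)
open import Data.List.Relation.Unary.Any using (here; there; index)
open import Data.List.Relation.Unary.Any.Properties using (lookup-index)
open import Data.List.Relation.Unary.Unique.Propositional using (Unique)
import Data.List.Relation.Unary.Unique.Propositional.Properties as Unique
open import Data.Nat using (ℕ; zero; suc; _≤_; _≤?_)
open import Data.Nat.Properties using (_≟_; ≡-irrelevant)
open import Data.Product using (Σ; _×_; _,_; proj₂)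
open import Data.Product.Properties using (×-≡,≡→≡)
open import Data.Vec using (Vec; []; _∷_)
open import Data.Vec.Properties using (∷-injective)
open import Function using (_∘_)
open import Function.Bundles using (_↔_; mk↔ₛ′; Inverse)
open import Level using (Level)
open import Relation.Binary.PropositionalEquality using (_≡_; refl; sym; cong; subst)
open import Relation.Nullary using (Irrelevant; _×-dec_; _→-dec_)
open import Relation.Nullary.Decidable using (True; toWitness)
open import Relation.Unary using (Pred; Decidable)

private
  variable
    a p : Level
    A : Set a

lookup-injective : {xs : List A} → Unique xs → ∀ {i j} → lookup xs i ≡ lookup xs j → i ≡ j
lookup-injective {xs = _ ∷ _} _         {zero}  {zero}  _  = refl
lookup-injective              (x∉ ∷ _)  {zero}  {suc j} eq = ⊥-elim (All.lookup x∉ (∈-lookup j) eq)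
lookup-injective              (x∉ ∷ _)  {suc i} {zero}  eq = ⊥-elim (All.lookup x∉ (∈-lookup i) (sym eq))
lookup-injective              (_ ∷ xs!) {suc i} {suc j} eq = cong suc (lookup-injective xs! eq)

all-by-enumeration : {xs : List A} {P : Pred A p} (P? : Decidable P) →
                     (∀ x → x ∈ xs) → True (All.all? P? xs) → ∀ x → P x
all-by-enumeration P? complete ok x = All.lookup (toWitness ok) (complete x)

module _ {P : Pred A p} (P-irrelevant : ∀ {x} → Irrelevant (P x)) where

  proj₁-injective : ∀ {x y} {px : P x} {py : P y} → x ≡ y → (x , px) ≡ (y , py)
  proj₁-injective refl = cong (_ ,_) (P-irrelevant _ _)

  unique-list↔ : (ys : List A) → Unique ys →
                 (∀ {x} → x ∈ ys → P x) → (∀ {x} → P x → x ∈ ys) →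
                 Fin (length ys) ↔ Σ A P
  unique-list↔ ys ys! sound complete = mk↔ₛ′ to from to∘from from∘to
    where
    to : Fin (length ys) → Σ A P
    to i = lookup ys i , sound (∈-lookup i)

    from : Σ A P → Fin (length ys)
    from (_ , px) = index (complete px)

    to∘from : ∀ xp → to (from xp) ≡ xp
    to∘from (_ , px) = proj₁-injective (sym (lookup-index (complete px)))

    from∘to : ∀ i → from (to i) ≡ i
    from∘to i = lookup-injective ys! (sym (lookup-index (complete (sound (∈-lookup i)))))

  filter-enumeration↔ : (P? : Decidable P) (xs : List A) → Unique xs → (∀ x → x ∈ xs) →
                        Fin (length (filter P? xs)) ↔ Σ A P
  filter-enumeration↔ P? xs xs! complete =
    unique-list↔ (filter P? xs) (Unique.filter⁺ P? xs!)
      (proj₂ ∘ ∈-filter⁻ P? {xs = xs}) (∈-filter⁺ P? (complete _))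

vectors : List A → ∀ n → List (Vec A n)
vectors xs zero    = [] ∷ []
vectors xs (suc n) = cartesianProductWith _∷_ xs (vectors xs n)

∈-vectors : {xs : List A} → (∀ x → x ∈ xs) → ∀ {n} (v : Vec A n) → v ∈ vectors xs n
∈-vectors complete []      = here refl
∈-vectors complete (x ∷ v) = ∈-cartesianProductWith⁺ _∷_ (complete x) (∈-vectors complete v)

vectors-unique : {xs : List A} → Unique xs → ∀ n → Unique (vectors xs n)
vectors-unique xs! zero    = All.[] ∷ []
vectors-unique xs! (suc n) =
  Unique.cartesianProductWith⁺ _∷_ ∷-injective xs! (vectors-unique xs! n)

booleans : List Bool
booleans = true ∷ false ∷ []

∈-booleans : ∀ b → b ∈ booleans
∈-booleans true  = here refl
∈-booleans false = there (here refl)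

booleans-unique : Unique booleans
booleans-unique = ((λ ()) All.∷ All.[]) ∷ All.[] ∷ []

vertexSets : ∀ n → List (VSet n)
vertexSets n = cartesianProduct (vectors booleans n) (vectors booleans n)

∈-vertexSets : ∀ {n} (D : VSet n) → D ∈ vertexSets n
∈-vertexSets (S₁ , S₂) =
  ∈-cartesianProduct⁺ (∈-vectors ∈-booleans S₁) (∈-vectors ∈-booleans S₂)

vertexSets-unique : ∀ n → Unique (vertexSets n)
vertexSets-unique n =
  Unique.cartesianProduct⁺ (vectors-unique booleans-unique n) (vectors-unique booleans-unique n)

DominatingOfSize : ∀ {n} → ℕ → VSet n → Set
DominatingOfSize γ D = Dominating D × size D ≡ γ

dominatingOfSize? : ∀ {n} γ → Decidable (DominatingOfSize {n} γ)
dominatingOfSize? γ D = T? _ ×-dec (size D ≟ γ)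

dominatingOfSize-irrelevant : ∀ {n γ} {D : VSet n} → Irrelevant (DominatingOfSize γ D)
dominatingOfSize-irrelevant (d , e) (d′ , e′) = ×-≡,≡→≡ (T-irrelevant d d′ , ≡-irrelevant e e′)

dominationBound? : ∀ {n} γ → Decidable (λ (D : VSet n) → Dominating D → γ ≤ size D)
dominationBound? γ D = T? _ →-dec (γ ≤? size D)

zeta-by-search : ∀ n γ k →
                 True (All.all? (dominationBound? γ) (vertexSets n)) →
                 length (filter (dominatingOfSize? γ) (vertexSets n)) ≡ suc k →
                 Zeta≡ n (suc k)
zeta-by-search n γ k bound count = γ , (Inverse.to minimumSets zero , lowerBound) , minimumSets
  where
  lowerBound : ∀ D → Dominating D → γ ≤ size D
  lowerBound = all-by-enumeration (dominationBound? γ) ∈-vertexSets bound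

  minimumSets : Fin (suc k) ↔ Σ (VSet n) (DominatingOfSize γ)
  minimumSets = subst (λ m → Fin m ↔ Σ (VSet n) (DominatingOfSize γ)) count
    (filter-enumeration↔ (dominatingOfSize-irrelevant {n}) (dominatingOfSize? γ)
      (vertexSets n) (vertexSets-unique n) ∈-vertexSets)

proposition3p16 : Zeta≡ 3 9 × Zeta≡ 6 51
proposition3p16 = zeta-by-search 3 2 8 _ refl , zeta-by-search 6 4 50 _ refl
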